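{- For every integer $n\ge 2$ there exists a graph $D_n$ on $n$ vertices such that no induced subgraph of $D_n$ has more than $3n/\ln n$ vertices with the same degree (degrees computed in the induced subgraph).
   Context: All graphs are finite, simple and undirected. -}

module Defs where

open import Data.Nat using (ℕ; zero; suc; _+_; _*_; _^_; _≤_; _≡ᵇ_)
open import Data.Bool using (Bool; true; false; _∧_)
open import Data.Fin using (Fin)
open import Data.Fin.Subset using (Subset; _∩_; ∣_∣)
open import Data.Vec using (tabulate)
open import Data.Product using (∃; _×_)
open import Relation.Binary.PropositionalEquality using (_≡_)

record Graph (n : ℕ) : Set where
  field
    adj   : Fin n → Fin n → Bool
    sym   : ∀ u v → adj u v ≡ adj v u
    irrefl : ∀ v → adj v v ≡ false
open Graph public

nbr : ∀ {n} → Graph n → Fin n → Subset n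
nbr G v = tabulate (adj G v)

degIn : ∀ {n} → Graph n → Subset n → Fin n → ℕ
degIn G S v = ∣ S ∩ nbr G v ∣

countDeg : ∀ {n} → Graph n → Subset n → ℕ → ℕ
countDeg G S d = ∣ tabulate (λ v → Data.Vec.lookup S v ∧ (degIn G S v ≡ᵇ d)) ∣
  where import Data.Vec

-- AtMost3nOverLn n c  encodes the real inequality  c ≤ 3n / ln n  (for n ≥ 2).
-- For n ≥ 2 this is  c · ln n ≤ 3n, i.e.  n^c ≤ e^(3n).  Since e^(3n) is
-- irrational and (1 + 1/m)^m increases strictly to e, this is equivalent to
-- the existence of m ≥ 1 with  n^c ≤ (1 + 1/m)^(3nm), i.e. (clearing
-- denominators)  n^c · m^(3nm) ≤ (m+1)^(3nm).
AtMost3nOverLn : ℕ → ℕ → Set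
AtMost3nOverLn n c =
  ∃ λ m → (1 ≤ m) × (n ^ c * m ^ (3 * n * m) ≤ suc m ^ (3 * n * m))

{-# OPTIONS --safe #-}
module Submission where

open import Defs hiding (sym)
open import Data.Bool using (Bool; true; false; not; _∧_; if_then_else_)
open import Data.Bool.Properties using (∧-identityʳ; ∧-zeroʳ)
open import Data.Fin using (Fin; zero; suc; splitAt; _↑ˡ_; _↑ʳ_; _≟_)
open import Data.Fin.Properties using (splitAt-↑ˡ; splitAt-↑ʳ)
open import Data.Fin.Subset using (Subset; _∩_; ∣_∣; ⊥)
open import Data.Fin.Subset.Properties using (∣⊥∣≡0; ∣p∣≤n; ∩-zeroʳ; ∩-identityʳ)
open import Data.List as List using (List; []; _∷_; [_])
open import Data.List.Relation.Binary.Pointwise using (Pointwise; []; _∷_)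
open import Data.Nat
  using (ℕ; zero; suc; _+_; _*_; _^_; _∸_; _⊓_; _≤_; _<_; _≡ᵇ_; _≤ᵇ_; _≤?_; z≤n; s≤s;
         ⌊_/2⌋; ⌈_/2⌉; NonZero; >-nonZero)
open import Data.Nat.DivMod using (_/_; _%_; m≡m%n+[m/n]*n; m%n<n; m/n*n≤m)
open import Data.Nat.ListAction using (sum)
open import Data.Nat.ListAction.Properties using (sum-++)
open import Data.Nat.Properties hiding (_≟_)
open import Data.Nat.Tactic.RingSolver using (solve-∀; solve)
open import Data.Product using (∃; ∃₂; _×_; _,_)
open import Data.Sum using (_⊎_; inj₁; inj₂)
open import Data.Vec using (_∷_; []; _++_; tabulate; replicate; lookup)
import Data.Vec as Vec
open import Data.Vec.Properties using (tabulate-cong; tabulate∘lookup; zipWith-++; lookup-++ˡ; lookup-++ʳ)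
open import Function using (_∘_; _⇔_; mk⇔; Equivalence)
open import Relation.Binary.PropositionalEquality
  using (_≡_; refl; sym; trans; cong; cong₂; subst; module ≡-Reasoning)
open import Relation.Nullary using (yes; no; does; contradiction; ofʸ; ofⁿ)
open import Relation.Nullary.Decidable using (dec-true; does-⇔)
open import Relation.Nullary.Reflects using (fromEquivalence)

-- D_n is a disjoint union of cliques.  A clique K_s meeting S in t vertices
-- contributes t vertices of degree t - 1 to G[S] and nothing else, so at most
-- t · #{cliques of size ≥ t} vertices of G[S] have degree t - 1.  The clique
-- sizes are a copies of 2^L and a · 2^(L-1-j) copies of 2^j for j < L (cut down
-- to n vertices): then t · #{sizes ≥ t} ≤ a · 2^L =: B for every t, while the
-- sizes add up to a · 2^(L-1) · (L + 2).  For n ≤ 2^e ≤ 2n, L = ⌊e/2⌋ and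
-- a ≈ 2n / (2^L · (L + 2)) this gives e · B ≤ 4n, so a count c ≤ B satisfies
-- n^c ≤ 2^(e·B) ≤ 16^n ≤ (9/8)^(24n), which is how AtMost3nOverLn encodes c ≤ 3n / ln n.

tabulate-const : ∀ {A : Set} {n} (x : A) → tabulate {n = n} (λ _ → x) ≡ replicate n x
tabulate-const {n = zero}  x = refl
tabulate-const {n = suc n} x = cong (x ∷_) (tabulate-const x)

tabulate-++ : ∀ {A : Set} m {n} (f : Fin (m + n) → A) →
              tabulate f ≡ tabulate (f ∘ (_↑ˡ n)) ++ tabulate (f ∘ (m ↑ʳ_))
tabulate-++ zero    f = refl
tabulate-++ (suc m) f = cong (f zero ∷_) (tabulate-++ m (f ∘ suc))

∣p++q∣≡∣p∣+∣q∣ : ∀ {m n} (p : Subset m) (q : Subset n) → ∣ p ++ q ∣ ≡ ∣ p ∣ + ∣ q ∣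
∣p++q∣≡∣p∣+∣q∣ []          q = refl
∣p++q∣≡∣p∣+∣q∣ (true  ∷ p) q = cong suc (∣p++q∣≡∣p∣+∣q∣ p q)
∣p++q∣≡∣p∣+∣q∣ (false ∷ p) q = ∣p++q∣≡∣p∣+∣q∣ p q

∣[p++q]∩[p′++q′]∣≡∣p∩p′∣+∣q∩q′∣ : ∀ {m n} (p p′ : Subset m) (q q′ : Subset n) →
                                  ∣ (p ++ q) ∩ (p′ ++ q′) ∣ ≡ ∣ p ∩ p′ ∣ + ∣ q ∩ q′ ∣
∣[p++q]∩[p′++q′]∣≡∣p∩p′∣+∣q∩q′∣ p p′ q q′ =
  trans (cong ∣_∣ (zipWith-++ _∧_ p q p′ q′)) (∣p++q∣≡∣p∣+∣q∣ (p ∩ p′) (q ∩ q′))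

∣p∩⊥∣≡0 : ∀ {n} (p : Subset n) → ∣ p ∩ ⊥ ∣ ≡ 0
∣p∩⊥∣≡0 {n} p = trans (cong ∣_∣ (∩-zeroʳ p)) (∣⊥∣≡0 n)

-- Disjoint unions of cliques

complete : ∀ n → Graph n
complete n = record
  { adj    = λ u v → not (does (u ≟ v))
  ; sym    = λ u v → cong not (does-⇔ (mk⇔ sym sym) (u ≟ v) (v ≟ u))
  ; irrefl = λ v → cong not (dec-true (v ≟ v) refl)
  }

module _ {m n} (G : Graph m) (H : Graph n) where

  private
    adj⊎ : Fin m ⊎ Fin n → Fin m ⊎ Fin n → Bool
    adj⊎ (inj₁ u) (inj₁ v) = adj G u v
    adj⊎ (inj₂ u) (inj₂ v) = adj H u v
    adj⊎ _        _        = false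

    adj⊎-sym : ∀ x y → adj⊎ x y ≡ adj⊎ y x
    adj⊎-sym (inj₁ u) (inj₁ v) = Graph.sym G u v
    adj⊎-sym (inj₁ u) (inj₂ v) = refl
    adj⊎-sym (inj₂ u) (inj₁ v) = refl
    adj⊎-sym (inj₂ u) (inj₂ v) = Graph.sym H u v

    adj⊎-irrefl : ∀ x → adj⊎ x x ≡ false
    adj⊎-irrefl (inj₁ u) = irrefl G u
    adj⊎-irrefl (inj₂ u) = irrefl H u

  _⊕_ : Graph (m + n)
  _⊕_ = record
    { adj    = λ u v → adj⊎ (splitAt m u) (splitAt m v)
    ; sym    = λ u v → adj⊎-sym (splitAt m u) (splitAt m v)
    ; irrefl = λ v → adj⊎-irrefl (splitAt m v)
    }

  nbr-⊕-↑ˡ : ∀ i → nbr _⊕_ (i ↑ˡ n) ≡ nbr G i ++ ⊥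
  nbr-⊕-↑ˡ i = trans (tabulate-++ m _) (cong₂ _++_
    (tabulate-cong λ j → cong₂ adj⊎ (splitAt-↑ˡ m i n) (splitAt-↑ˡ m j n))
    (trans (tabulate-cong λ j → cong₂ adj⊎ (splitAt-↑ˡ m i n) (splitAt-↑ʳ m n j))
           (tabulate-const false)))

  nbr-⊕-↑ʳ : ∀ i → nbr _⊕_ (m ↑ʳ i) ≡ ⊥ ++ nbr H i
  nbr-⊕-↑ʳ i = trans (tabulate-++ m _) (cong₂ _++_
    (trans (tabulate-cong λ j → cong₂ adj⊎ (splitAt-↑ʳ m n i) (splitAt-↑ˡ m j n))
           (tabulate-const false))
    (tabulate-cong λ j → cong₂ adj⊎ (splitAt-↑ʳ m n i) (splitAt-↑ʳ m n j)))

  degIn-⊕-↑ˡ : ∀ S T i → degIn _⊕_ (S ++ T) (i ↑ˡ n) ≡ degIn G S i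
  degIn-⊕-↑ˡ S T i = begin
    ∣ (S ++ T) ∩ nbr _⊕_ (i ↑ˡ n) ∣
      ≡⟨ cong (λ x → ∣ (S ++ T) ∩ x ∣) (nbr-⊕-↑ˡ i) ⟩
    ∣ (S ++ T) ∩ (nbr G i ++ ⊥) ∣
      ≡⟨ ∣[p++q]∩[p′++q′]∣≡∣p∩p′∣+∣q∩q′∣ S (nbr G i) T ⊥ ⟩
    ∣ S ∩ nbr G i ∣ + ∣ T ∩ ⊥ ∣
      ≡⟨ cong (∣ S ∩ nbr G i ∣ +_) (∣p∩⊥∣≡0 T) ⟩
    ∣ S ∩ nbr G i ∣ + 0
      ≡⟨ +-identityʳ _ ⟩
    ∣ S ∩ nbr G i ∣ ∎
    where open ≡-Reasoning

  degIn-⊕-↑ʳ : ∀ S T i → degIn _⊕_ (S ++ T) (m ↑ʳ i) ≡ degIn H T i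
  degIn-⊕-↑ʳ S T i = begin
    ∣ (S ++ T) ∩ nbr _⊕_ (m ↑ʳ i) ∣
      ≡⟨ cong (λ x → ∣ (S ++ T) ∩ x ∣) (nbr-⊕-↑ʳ i) ⟩
    ∣ (S ++ T) ∩ (⊥ ++ nbr H i) ∣
      ≡⟨ ∣[p++q]∩[p′++q′]∣≡∣p∩p′∣+∣q∩q′∣ S ⊥ T (nbr H i) ⟩
    ∣ S ∩ ⊥ ∣ + ∣ T ∩ nbr H i ∣
      ≡⟨ cong (_+ ∣ T ∩ nbr H i ∣) (∣p∩⊥∣≡0 S) ⟩
    ∣ T ∩ nbr H i ∣ ∎
    where open ≡-Reasoning

  countDeg-⊕ : ∀ S T d → countDeg _⊕_ (S ++ T) d ≡ countDeg G S d + countDeg H T d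
  countDeg-⊕ S T d = trans
    (cong ∣_∣ (trans (tabulate-++ m _) (cong₂ _++_
      (tabulate-cong λ i → cong₂ hasDeg (lookup-++ˡ S T i) (degIn-⊕-↑ˡ S T i))
      (tabulate-cong λ i → cong₂ hasDeg (lookup-++ʳ S T i) (degIn-⊕-↑ʳ S T i)))))
    (∣p++q∣≡∣p∣+∣q∣ (tabulate λ i → hasDeg (lookup S i) (degIn G S i))
                    (tabulate λ i → hasDeg (lookup T i) (degIn H T i)))
    where
    hasDeg : Bool → ℕ → Bool
    hasDeg inS k = inS ∧ (k ≡ᵇ d)

degIn-complete : ∀ {n} (S : Subset n) v → lookup S v ≡ true → suc (degIn (complete n) S v) ≡ ∣ S ∣
degIn-complete (true  ∷ S) zero    _   =
  cong (suc ∘ ∣_∣) (trans (cong (S ∩_) (tabulate-const true)) (∩-identityʳ S))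
degIn-complete (true  ∷ S) (suc v) v∈S = cong suc (degIn-complete S v v∈S)
degIn-complete (false ∷ S) (suc v) v∈S = degIn-complete S v v∈S

countDeg-complete : ∀ {n} (S : Subset n) d →
                    countDeg (complete n) S d ≡ (if ∣ S ∣ ≡ᵇ suc d then ∣ S ∣ else 0)
countDeg-complete {n} S d =
  trans (cong ∣_∣ (tabulate-cong hasDeg-complete)) (count-inS∧ (∣ S ∣ ≡ᵇ suc d))
  where
  hasDeg-complete : ∀ v →
                    lookup S v ∧ (degIn (complete n) S v ≡ᵇ d) ≡ lookup S v ∧ (∣ S ∣ ≡ᵇ suc d)
  hasDeg-complete v with lookup S v in v∈S
  ... | true  = cong (_≡ᵇ suc d) (degIn-complete S v v∈S)
  ... | false = refl

  count-inS∧ : ∀ b → ∣ tabulate (λ v → lookup S v ∧ b) ∣ ≡ (if b then ∣ S ∣ else 0)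
  count-inS∧ true  =
    cong ∣_∣ (trans (tabulate-cong (λ v → ∧-identityʳ (lookup S v))) (tabulate∘lookup S))
  count-inS∧ false =
    trans (cong ∣_∣ (trans (tabulate-cong (λ v → ∧-zeroʳ (lookup S v))) (tabulate-const false)))
          (∣⊥∣≡0 n)

countAtLeast : ℕ → List ℕ → ℕ
countAtLeast t []       = 0
countAtLeast t (s ∷ ss) = if t ≤ᵇ s then suc (countAtLeast t ss) else countAtLeast t ss

countAtLeast-++ : ∀ t xs ys → countAtLeast t (xs List.++ ys) ≡ countAtLeast t xs + countAtLeast t ys
countAtLeast-++ t []       ys = refl
countAtLeast-++ t (x ∷ xs) ys with t ≤ᵇ x
... | true  = cong suc (countAtLeast-++ t xs ys)
... | false = countAtLeast-++ t xs ys

countAtLeast-mono : ∀ {t xs ys} → Pointwise _≤_ xs ys → countAtLeast t xs ≤ countAtLeast t ys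
countAtLeast-mono [] = z≤n
countAtLeast-mono {t} (_∷_ {x} {y} x≤y xs≤ys)
  with t ≤ᵇ x | ≤ᵇ-reflects-≤ t x | t ≤ᵇ y | ≤ᵇ-reflects-≤ t y
... | true  | _       | true  | _       = s≤s (countAtLeast-mono xs≤ys)
... | true  | ofʸ t≤x | false | ofⁿ t≰y = contradiction (≤-trans t≤x x≤y) t≰y
... | false | _       | true  | _       = m≤n⇒m≤1+n (countAtLeast-mono xs≤ys)
... | false | _       | false | _       = countAtLeast-mono xs≤ys

countDeg-complete≤ : ∀ {n} (S : Subset n) d →
                     countDeg (complete n) S d ≤ suc d * countAtLeast (suc d) [ n ]
countDeg-complete≤ {n} S d rewrite countDeg-complete S d
  with ∣ S ∣ ≡ᵇ suc d | fromEquivalence (≡ᵇ⇒≡ ∣ S ∣ (suc d)) (≡⇒≡ᵇ ∣ S ∣ (suc d))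
     | suc d ≤ᵇ n     | ≤ᵇ-reflects-≤ (suc d) n
... | false | _           | _     | _         = z≤n
... | true  | ofʸ ∣S∣≡1+d | true  | _         =
  ≤-reflexive (trans ∣S∣≡1+d (sym (*-identityʳ (suc d))))
... | true  | ofʸ ∣S∣≡1+d | false | ofⁿ 1+d≰n =
  contradiction (subst (_≤ n) ∣S∣≡1+d (∣p∣≤n S)) 1+d≰n

cliques : (ss : List ℕ) → Graph (sum ss)
cliques []       = complete 0
cliques (s ∷ ss) = complete s ⊕ cliques ss

countDeg-cliques≤ : ∀ ss (S : Subset (sum ss)) d →
                    countDeg (cliques ss) S d ≤ suc d * countAtLeast (suc d) ss
countDeg-cliques≤ []       [] d = z≤n
countDeg-cliques≤ (s ∷ ss) S  d with Vec.splitAt s S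
... | S₁ , S₂ , refl = begin
  countDeg (complete s ⊕ cliques ss) (S₁ ++ S₂) d
    ≡⟨ countDeg-⊕ (complete s) (cliques ss) S₁ S₂ d ⟩
  countDeg (complete s) S₁ d + countDeg (cliques ss) S₂ d
    ≤⟨ +-mono-≤ (countDeg-complete≤ S₁ d) (countDeg-cliques≤ ss S₂ d) ⟩
  suc d * countAtLeast (suc d) [ s ] + suc d * countAtLeast (suc d) ss
    ≡⟨ *-distribˡ-+ (suc d) (countAtLeast (suc d) [ s ]) (countAtLeast (suc d) ss) ⟨
  suc d * (countAtLeast (suc d) [ s ] + countAtLeast (suc d) ss)
    ≡⟨ cong (suc d *_) (countAtLeast-++ (suc d) [ s ] ss) ⟨
  suc d * countAtLeast (suc d) (s ∷ ss) ∎
  where open ≤-Reasoning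

truncate : ℕ → List ℕ → List ℕ
truncate n []       = []
truncate n (s ∷ ss) = s ⊓ n ∷ truncate (n ∸ s) ss

truncate-≤ : ∀ n ss → Pointwise _≤_ (truncate n ss) ss
truncate-≤ n []       = []
truncate-≤ n (s ∷ ss) = m⊓n≤m s n ∷ truncate-≤ (n ∸ s) ss

sum-truncate : ∀ {n} ss → n ≤ sum ss → sum (truncate n ss) ≡ n
sum-truncate     []       n≤0   = sym (n≤0⇒n≡0 n≤0)
sum-truncate {n} (s ∷ ss) n≤Σss =
  trans (cong (s ⊓ n +_) (sum-truncate ss (m≤n+o⇒m∸n≤o n s n≤Σss))) (m⊓n+n∸m≡n s n)

truncated-cliques : ∀ n ss → n ≤ sum ss →
                    ∃ λ (D : Graph n) → ∀ S d → countDeg D S d ≤ suc d * countAtLeast (suc d) ss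
truncated-cliques n ss n≤Σss =
  subst (λ k → ∃ λ (D : Graph k) → ∀ S d → countDeg D S d ≤ suc d * countAtLeast (suc d) ss)
    (sum-truncate ss n≤Σss)
    (cliques (truncate n ss) , λ S d →
      ≤-trans (countDeg-cliques≤ (truncate n ss) S d)
              (*-monoʳ-≤ (suc d) (countAtLeast-mono (truncate-≤ n ss))))

-- Dyadic clique sizes

countAtLeast-replicate : ∀ t k s → countAtLeast t (List.replicate k s) ≡ (if t ≤ᵇ s then k else 0)
countAtLeast-replicate t zero    s with t ≤ᵇ s
... | true  = refl
... | false = refl
countAtLeast-replicate t (suc k) s with t ≤ᵇ s | countAtLeast-replicate t k s
... | true  | count≡k = cong suc count≡k
... | false | count≡0 = count≡0

t≤2*s⇔⌈t/2⌉≤s : ∀ t s → t ≤ 2 * s ⇔ ⌈ t /2⌉ ≤ s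
t≤2*s⇔⌈t/2⌉≤s t s = mk⇔
  (λ t≤2s → ≤-trans (⌈n/2⌉-mono t≤2s)
                     (≤-reflexive (trans (cong ⌈_/2⌉ 2*s≡s+s) (sym (n≡⌈n+n/2⌉ s)))))
  (λ ⌈t/2⌉≤s → begin
    t                    ≡⟨ ⌊n/2⌋+⌈n/2⌉≡n t ⟨
    ⌊ t /2⌋ + ⌈ t /2⌉    ≤⟨ +-monoˡ-≤ ⌈ t /2⌉ (⌊n/2⌋≤⌈n/2⌉ t) ⟩
    ⌈ t /2⌉ + ⌈ t /2⌉    ≤⟨ +-mono-≤ ⌈t/2⌉≤s ⌈t/2⌉≤s ⟩
    s + s                ≡⟨ 2*s≡s+s ⟨
    2 * s                ∎)
  where
  open ≤-Reasoning
  2*s≡s+s : 2 * s ≡ s + s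
  2*s≡s+s = cong (s +_) (+-identityʳ s)

countAtLeast-map-2* : ∀ t xs → countAtLeast t (List.map (2 *_) xs) ≡ countAtLeast ⌈ t /2⌉ xs
countAtLeast-map-2* t []       = refl
countAtLeast-map-2* t (x ∷ xs)
  rewrite does-⇔ (t≤2*s⇔⌈t/2⌉≤s t x) (t ≤? 2 * x) (⌈ t /2⌉ ≤? x)
  with ⌈ t /2⌉ ≤ᵇ x
... | true  = cong suc (countAtLeast-map-2* t xs)
... | false = countAtLeast-map-2* t xs

replicate-bound : ∀ k t → t * countAtLeast t (List.replicate k 1) ≤ k
replicate-bound k zero    = z≤n
replicate-bound k 1       rewrite countAtLeast-replicate 1 k 1 = ≤-reflexive (*-identityˡ k)
replicate-bound k (suc (suc u))
  rewrite countAtLeast-replicate (2 + u) k 1 | *-zeroʳ (2 + u) = z≤n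

doubling-bound : ∀ {B} xs → (∀ t → t * countAtLeast t xs ≤ B) →
                 ∀ t → t * countAtLeast t (List.map (2 *_) xs List.++ List.replicate B 1) ≤ 2 * B
doubling-bound     xs bound zero = z≤n
doubling-bound {B} xs bound 1    = begin
  1 * countAtLeast 1 (List.map (2 *_) xs List.++ List.replicate B 1)
    ≡⟨ *-identityˡ _ ⟩
  countAtLeast 1 (List.map (2 *_) xs List.++ List.replicate B 1)
    ≡⟨ countAtLeast-++ 1 (List.map (2 *_) xs) (List.replicate B 1) ⟩
  countAtLeast 1 (List.map (2 *_) xs) + countAtLeast 1 (List.replicate B 1)
    ≡⟨ cong₂ _+_ (countAtLeast-map-2* 1 xs) (countAtLeast-replicate 1 B 1) ⟩
  countAtLeast 1 xs + B
    ≤⟨ +-monoˡ-≤ B (subst (_≤ B) (*-identityˡ _) (bound 1)) ⟩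
  B + B
    ≡⟨ cong (B +_) (+-identityʳ B) ⟨
  2 * B ∎
  where open ≤-Reasoning
doubling-bound {B} xs bound t@(suc (suc _)) = begin
  t * countAtLeast t (List.map (2 *_) xs List.++ List.replicate B 1)
    ≡⟨ cong (t *_) (countAtLeast-++ t (List.map (2 *_) xs) (List.replicate B 1)) ⟩
  t * (countAtLeast t (List.map (2 *_) xs) + countAtLeast t (List.replicate B 1))
    ≡⟨ cong (t *_) (cong₂ _+_ (countAtLeast-map-2* t xs) (countAtLeast-replicate t B 1)) ⟩
  t * (countAtLeast h xs + 0)
    ≡⟨ cong (t *_) (+-identityʳ (countAtLeast h xs)) ⟩
  t * countAtLeast h xs
    ≤⟨ *-monoˡ-≤ (countAtLeast h xs) (Equivalence.from (t≤2*s⇔⌈t/2⌉≤s t h) ≤-refl) ⟩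
  2 * h * countAtLeast h xs
    ≡⟨ *-assoc 2 h (countAtLeast h xs) ⟩
  2 * (h * countAtLeast h xs)
    ≤⟨ *-monoʳ-≤ 2 (bound h) ⟩
  2 * B ∎
  where
  open ≤-Reasoning
  h = ⌈ t /2⌉

dyadic : ℕ → ℕ → List ℕ
dyadic a zero    = List.replicate a 1
dyadic a (suc L) = List.map (2 *_) (dyadic a L) List.++ List.replicate (a * 2 ^ L) 1

dyadic-bound : ∀ a L t → t * countAtLeast t (dyadic a L) ≤ a * 2 ^ L
dyadic-bound a zero    t = ≤-trans (replicate-bound a t) (≤-reflexive (sym (*-identityʳ a)))
dyadic-bound a (suc L) t =
  ≤-trans (doubling-bound (dyadic a L) (dyadic-bound a L) t) (≤-reflexive (x*[y*z]≡y*[x*z] 2 a (2 ^ L)))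
  where
  x*[y*z]≡y*[x*z] : ∀ x y z → x * (y * z) ≡ y * (x * z)
  x*[y*z]≡y*[x*z] = solve-∀

sum-replicate-1 : ∀ k → sum (List.replicate k 1) ≡ k
sum-replicate-1 zero    = refl
sum-replicate-1 (suc k) = cong suc (sum-replicate-1 k)

sum-map-2* : ∀ xs → sum (List.map (2 *_) xs) ≡ 2 * sum xs
sum-map-2* []       = refl
sum-map-2* (x ∷ xs) = trans (cong (2 * x +_) (sum-map-2* xs)) (sym (*-distribˡ-+ 2 x (sum xs)))

sum-dyadic : ∀ a L → 2 * sum (dyadic a L) ≡ a * (2 ^ L * (2 + L))
sum-dyadic a zero    = trans (cong (2 *_) (sum-replicate-1 a)) (*-comm 2 a)
sum-dyadic a (suc L) = begin
  2 * sum (List.map (2 *_) (dyadic a L) List.++ List.replicate (a * 2 ^ L) 1)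
    ≡⟨ cong (2 *_) (trans (sum-++ (List.map (2 *_) (dyadic a L)) (List.replicate (a * 2 ^ L) 1))
                          (cong₂ _+_ (sum-map-2* (dyadic a L)) (sum-replicate-1 (a * 2 ^ L)))) ⟩
  2 * (2 * sum (dyadic a L) + a * 2 ^ L)
    ≡⟨ cong (λ y → 2 * (y + a * 2 ^ L)) (sum-dyadic a L) ⟩
  2 * (a * (2 ^ L * (2 + L)) + a * 2 ^ L)
    ≡⟨ double-step a (2 ^ L) L ⟩
  a * (2 * 2 ^ L * (3 + L)) ∎
  where
  open ≡-Reasoning
  double-step : ∀ a x L → 2 * (a * (x * (2 + L)) + a * x) ≡ a * (2 * x * (3 + L))
  double-step = solve-∀

-- Choice of the parameters

n<2^n : ∀ n → n < 2 ^ n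
n<2^n zero    = s≤s z≤n
n<2^n (suc n) = begin-strict
  suc n          ≤⟨ n<2^n n ⟩
  2 ^ n          <⟨ m<m+n (2 ^ n) (m^n>0 2 n) ⟩
  2 ^ n + 2 ^ n  ≡⟨ cong (2 ^ n +_) (+-identityʳ (2 ^ n)) ⟨
  2 ^ suc n      ∎
  where open ≤-Reasoning

m*[2+m]≤2^[1+m] : ∀ m → m * (2 + m) ≤ 2 ^ (1 + m)
m*[2+m]≤2^[1+m] 0 = z≤n
m*[2+m]≤2^[1+m] 1 = ≤ᵇ⇒≤ 3 4 _
m*[2+m]≤2^[1+m] 2 = ≤-refl
m*[2+m]≤2^[1+m] (suc (suc (suc j))) = begin
  (3 + j) * (5 + j)                ≡⟨ solve (j List.∷ List.[]) ⟩
  (2 + j) * (4 + j) + (7 + 2 * j)  ≤⟨ +-mono-≤ (m*[2+m]≤2^[1+m] (suc (suc j))) 7+2j≤2^[3+j] ⟩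
  2 ^ (3 + j) + 2 ^ (3 + j)        ≡⟨ cong (2 ^ (3 + j) +_) (+-identityʳ (2 ^ (3 + j))) ⟨
  2 ^ (4 + j)                      ∎
  where
  open ≤-Reasoning
  7+2j≤2^[3+j] : 7 + 2 * j ≤ 2 ^ (3 + j)
  7+2j≤2^[3+j] = begin
    7 + 2 * j    ≤⟨ +-monoʳ-≤ 7 (*-monoˡ-≤ j (≤ᵇ⇒≤ 2 8 _)) ⟩
    7 + 8 * j    <⟨ n<1+n (7 + 8 * j) ⟩
    8 + 8 * j    ≡⟨ *-suc 8 j ⟨
    8 * suc j    ≤⟨ *-monoʳ-≤ 8 (n<2^n j) ⟩
    8 * 2 ^ j    ≡⟨ ^-distribˡ-+-* 2 3 j ⟨
    2 ^ (3 + j)  ∎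

even-or-odd : ∀ e → ∃ λ m → e ≡ m + m ⊎ e ≡ suc (m + m)
even-or-odd zero    = 0 , inj₁ refl
even-or-odd (suc e) with even-or-odd e
... | m , inj₁ refl = m , inj₂ refl
... | m , inj₂ refl = suc m , inj₁ (cong suc (sym (+-suc m m)))

split-exponent : ∀ e → ∃₂ λ L k → ∃ λ D →
                 L + k ≡ e × e + D ≡ 2 * (2 + L) × e * (2 + L) ≤ 2 ^ k * D
split-exponent e with even-or-odd e
... | m , inj₁ refl = m , m , 4 , refl , solve (m List.∷ List.[]) , even-bound
  where
  open ≤-Reasoning
  2*[2*x]≡x*4 : ∀ x → 2 * (2 * x) ≡ x * 4
  2*[2*x]≡x*4 = solve-∀
  even-bound : (m + m) * (2 + m) ≤ 2 ^ m * 4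
  even-bound = begin
    (m + m) * (2 + m)              ≡⟨ solve (m List.∷ List.[]) ⟩
    2 * (m * (2 + m))              ≤⟨ *-monoʳ-≤ 2 (m*[2+m]≤2^[1+m] m) ⟩
    2 * (2 * 2 ^ m)                ≡⟨ 2*[2*x]≡x*4 (2 ^ m) ⟩
    2 ^ m * 4                      ∎
... | m , inj₂ refl = m , suc m , 3 , +-suc m m , solve (m List.∷ List.[]) , odd-bound
  where
  open ≤-Reasoning
  2*x+x≡x*3 : ∀ x → 2 * x + x ≡ x * 3
  2*x+x≡x*3 = solve-∀
  odd-bound : suc (m + m) * (2 + m) ≤ 2 ^ suc m * 3
  odd-bound = begin
    suc (m + m) * (2 + m)          ≡⟨ solve (m List.∷ List.[]) ⟩
    2 * (m * (2 + m)) + (2 + m)    ≤⟨ +-mono-≤ (*-monoʳ-≤ 2 (m*[2+m]≤2^[1+m] m)) (n<2^n (suc m)) ⟩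
    2 * 2 ^ suc m + 2 ^ suc m      ≡⟨ 2*x+x≡x*3 (2 ^ suc m) ⟩
    2 ^ suc m * 3                  ∎

power-of-two-between : ∀ n → 1 ≤ n → ∃ λ e → n ≤ 2 ^ e × 2 ^ e ≤ 2 * n
power-of-two-between 1             _ = 0 , ≤-refl , s≤s z≤n
power-of-two-between (suc (suc n)) _ with power-of-two-between (suc n) (s≤s z≤n)
... | e , 1+n≤2^e , 2^e≤2+2n with suc (suc n) ≤? 2 ^ e
...   | yes 2+n≤2^e = e , 2+n≤2^e , ≤-trans 2^e≤2+2n (*-monoʳ-≤ 2 (n≤1+n (suc n)))
...   | no  2+n≰2^e = suc e , ≤-trans 2+n≤2[1+n] (≤-reflexive 2[1+n]≡2^[1+e]) ,
                      ≤-trans (≤-reflexive (sym 2[1+n]≡2^[1+e])) (*-monoʳ-≤ 2 (n≤1+n (suc n)))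
  where
  2[1+n]≡2^[1+e] : 2 * suc n ≡ 2 ^ suc e
  2[1+n]≡2^[1+e] = cong (2 *_) (≤-antisym 1+n≤2^e (≤-pred (≰⇒> 2+n≰2^e)))
  2+n≤2[1+n] : suc (suc n) ≤ 2 * suc n
  2+n≤2[1+n] = ≤-trans (+-monoʳ-≤ 2 (m≤n*m n 2)) (≤-reflexive (sym (*-suc 2 n)))

ceiling-multiple : ∀ x w .{{_ : NonZero w}} → ∃ λ a → x ≤ a * w × a * w ≤ x + w
ceiling-multiple x w = suc (x / w) , x≤w+x/w*w , w+x/w*w≤x+w
  where
  open ≤-Reasoning
  x≤w+x/w*w : x ≤ w + x / w * w
  x≤w+x/w*w = begin
    x                  ≡⟨ m≡m%n+[m/n]*n x w ⟩
    x % w + x / w * w  ≤⟨ +-monoˡ-≤ (x / w * w) (<⇒≤ (m%n<n x w)) ⟩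
    w + x / w * w      ∎
  w+x/w*w≤x+w : w + x / w * w ≤ x + w
  w+x/w*w≤x+w = begin
    w + x / w * w      ≤⟨ +-monoʳ-≤ w (m/n*n≤m x w) ⟩
    w + x              ≡⟨ +-comm w x ⟩
    x + w              ∎

dyadic-budget : ∀ n a L k D → 2 ^ (L + k) ≤ 2 * n → (L + k) + D ≡ 2 * (2 + L) →
                (L + k) * (2 + L) ≤ 2 ^ k * D → a * (2 ^ L * (2 + L)) ≤ 2 * n + 2 ^ L * (2 + L) →
                (L + k) * (a * 2 ^ L) ≤ 4 * n
dyadic-budget n a L k D 2^e≤2n e+D≡2[2+L] e[2+L]≤2^k*D aW≤2n+W = *-cancelʳ-≤ _ _ (2 + L) (begin
  e * (a * 2 ^ L) * (2 + L)                ≡⟨ regroup e a (2 ^ L) (2 + L) ⟩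
  e * (a * W)                              ≤⟨ *-monoʳ-≤ e aW≤2n+W ⟩
  e * (2 * n + W)                          ≡⟨ expand e (2 * n) (2 ^ L) (2 + L) ⟩
  e * (2 * n) + 2 ^ L * (e * (2 + L))      ≤⟨ +-monoʳ-≤ (e * (2 * n)) (*-monoʳ-≤ (2 ^ L) e[2+L]≤2^k*D) ⟩
  e * (2 * n) + 2 ^ L * (2 ^ k * D)        ≡⟨ cong (e * (2 * n) +_) 2^L*[2^k*D]≡2^e*D ⟩
  e * (2 * n) + 2 ^ e * D                  ≤⟨ +-monoʳ-≤ (e * (2 * n)) (*-monoˡ-≤ D 2^e≤2n) ⟩
  e * (2 * n) + 2 * n * D                  ≡⟨ factor e (2 * n) D ⟩
  2 * n * (e + D)                          ≡⟨ cong (2 * n *_) e+D≡2[2+L] ⟩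
  2 * n * (2 * (2 + L))                    ≡⟨ solve (n List.∷ L List.∷ List.[]) ⟩
  4 * n * (2 + L)                          ∎)
  where
  open ≤-Reasoning
  e = L + k
  W = 2 ^ L * (2 + L)
  regroup : ∀ e a x y → e * (a * x) * y ≡ e * (a * (x * y))
  regroup = solve-∀
  expand : ∀ e z x y → e * (z + x * y) ≡ e * z + x * (e * y)
  expand = solve-∀
  factor : ∀ e z D → e * z + z * D ≡ z * (e + D)
  factor = solve-∀
  2^L*[2^k*D]≡2^e*D : 2 ^ L * (2 ^ k * D) ≡ 2 ^ e * D
  2^L*[2^k*D]≡2^e*D = trans (sym (*-assoc (2 ^ L) (2 ^ k) D)) (cong (_* D) (sym (^-distribˡ-+-* 2 L k)))

dyadic-parameters : ∀ n → 1 ≤ n → ∃₂ λ a L → ∃ λ e →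
                    2 * n ≤ a * (2 ^ L * (2 + L)) × n ≤ 2 ^ e × e * (a * 2 ^ L) ≤ 4 * n
dyadic-parameters n 1≤n with power-of-two-between n 1≤n
... | e , n≤2^e , 2^e≤2n with split-exponent e
...   | L , k , D , refl , e+D≡2[2+L] , e[2+L]≤2^k*D =
  let a , 2n≤aW , aW≤2n+W =
        ceiling-multiple (2 * n) (2 ^ L * (2 + L)) {{m*n≢0 (2 ^ L) (2 + L) {{m^n≢0 2 L}}}}
  in a , L , L + k , 2n≤aW , n≤2^e , dyadic-budget n a L k D 2^e≤2n e+D≡2[2+L] e[2+L]≤2^k*D aW≤2n+W

n^c≤16^n : ∀ {n c B e} → 1 ≤ n → c ≤ B → n ≤ 2 ^ e → e * B ≤ 4 * n → n ^ c ≤ 16 ^ n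
n^c≤16^n {n} {c} {B} {e} 1≤n c≤B n≤2^e e*B≤4n = begin
  n ^ c          ≤⟨ ^-monoʳ-≤ n {{>-nonZero 1≤n}} c≤B ⟩
  n ^ B          ≤⟨ ^-monoˡ-≤ B n≤2^e ⟩
  (2 ^ e) ^ B    ≡⟨ ^-*-assoc 2 e B ⟩
  2 ^ (e * B)    ≤⟨ ^-monoʳ-≤ 2 e*B≤4n ⟩
  2 ^ (4 * n)    ≡⟨ ^-*-assoc 2 4 n ⟨
  16 ^ n         ∎
  where open ≤-Reasoning

[m*n]^o≡m^o*n^o : ∀ m n o → (m * n) ^ o ≡ m ^ o * n ^ o
[m*n]^o≡m^o*n^o m n zero    = refl
[m*n]^o≡m^o*n^o m n (suc o) =
  trans (cong (m * n *_) ([m*n]^o≡m^o*n^o m n o)) ([m*n]*[o*p]≡[m*o]*[n*p] m n (m ^ o) (n ^ o))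

16^n⇒AtMost3nOverLn : ∀ n c → n ^ c ≤ 16 ^ n → AtMost3nOverLn n c
16^n⇒AtMost3nOverLn n c n^c≤16^n = 8 , s≤s z≤n , (begin
  n ^ c * 8 ^ (3 * n * 8)       ≤⟨ *-monoˡ-≤ (8 ^ (3 * n * 8)) n^c≤16^n ⟩
  16 ^ n * 8 ^ (3 * n * 8)      ≡⟨ cong (16 ^ n *_) (x^[3*n*8]≡[x^24]^n 8) ⟩
  16 ^ n * (8 ^ 24) ^ n         ≡⟨ [m*n]^o≡m^o*n^o 16 (8 ^ 24) n ⟨
  (16 * 8 ^ 24) ^ n             ≤⟨ ^-monoˡ-≤ n (≤ᵇ⇒≤ (16 * 8 ^ 24) (9 ^ 24) _) ⟩
  (9 ^ 24) ^ n                  ≡⟨ x^[3*n*8]≡[x^24]^n 9 ⟨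
  9 ^ (3 * n * 8)               ∎)
  where
  open ≤-Reasoning
  3*n*8≡24*n : 3 * n * 8 ≡ 24 * n
  3*n*8≡24*n = solve (n List.∷ List.[])
  x^[3*n*8]≡[x^24]^n : ∀ x → x ^ (3 * n * 8) ≡ (x ^ 24) ^ n
  x^[3*n*8]≡[x^24]^n x = trans (cong (x ^_) 3*n*8≡24*n) (sym (^-*-assoc x 24 n))

lemma5p1 : (n : ℕ) → 2 ≤ n →
    ∃ λ (D : Graph n) → (S : Subset n) → (d : ℕ) →
      AtMost3nOverLn n (countDeg D S d)
lemma5p1 n 2≤n =
  let a , L , e , 2n≤2Σ , n≤2^e , e*B≤4n = dyadic-parameters n 1≤n
      D , countDeg≤ = truncated-cliques n (dyadic a L)
                        (*-cancelˡ-≤ 2 (≤-trans 2n≤2Σ (≤-reflexive (sym (sum-dyadic a L)))))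
  in D , λ S d → 16^n⇒AtMost3nOverLn n (countDeg D S d)
       (n^c≤16^n {B = a * 2 ^ L} {e} 1≤n (≤-trans (countDeg≤ S d) (dyadic-bound a L (suc d)))
                 n≤2^e e*B≤4n)
  where
  1≤n : 1 ≤ n
  1≤n = ≤-trans (s≤s z≤n) 2≤n
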